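{- Let $t$ be a positive integer and $B=\{v_1,\dots,v_t\}$. For every $t$-representative function $f\colon 2^B\to\mathbb{N}$ there exists a $t$-boundaried graph $G$ with boundary $B$ such that $\mathfrak{s}^0_G(S)=f(S)$ for every $S\subseteq B$.
   Context: A $t$-boundaried graph is a finite simple undirected graph with an injective labeling $\lambda\colon\{1,\dots,t\}\to V$; its boundary is the set of labeled vertices. For $S\subseteq B$, $\mathfrak{s}_G(S)$ is the maximum of $|X|$ over independent sets $X$ of $G$ with $X\cap B\subseteq S$, and $\mathfrak{s}^0_G(S)=\mathfrak{s}_G(S)-\mathfrak{s}_G(\emptyset)$. $\mathbb{N}$ includes $0$. A function $f\colon 2^B\to\mathbb{N}$ is a $t$-representative function if (1) $f(\emptyset)=0$; (2) $f(S')\le f(S)$ whenever $S'\subseteq S\subseteq B$; (3) for every nonempty $S\subseteq B$, $f(S)\le 1+\min_{v\in S}f(S\setminus\{v\})$. -}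

module Defs where

open import Data.Nat using (ℕ; suc; _+_; _∸_; _≤_)
open import Data.Bool using (Bool; true; false)
open import Data.Fin using (Fin)
open import Data.Fin.Subset using (Subset; _∈_; _⊆_; _-_; ∣_∣; ⊥; Nonempty)
open import Data.Product using (Σ; ∃; _×_; _,_)
open import Function.Definitions using (Injective)
open import Relation.Binary.PropositionalEquality using (_≡_)

record Graph : Set where
  field
    n      : ℕ
    adj    : Fin n → Fin n → Bool
    sym    : ∀ u v → adj u v ≡ adj v u
    irrefl : ∀ v → adj v v ≡ false

open Graph public

-- A t-boundaried graph: graph with injective labeling λ : {1..t} → V
-- (boundary labels are Fin t; boundary B = image of label).
record BGraph (t : ℕ) : Set where
  field
    graph    : Graph
    label    : Fin t → Fin (n graph)
    label-inj : Injective _≡_ _≡_ label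

open BGraph public

Independent : (G : Graph) → Subset (n G) → Set
Independent G X = ∀ u v → u ∈ X → v ∈ X → adj G u v ≡ false

-- X ∩ B ⊆ S, where S ⊆ B is given as a subset of the labels Fin t.
BoundaryWithin : ∀ {t} (G : BGraph t) → Subset (n (graph G)) → Subset t → Set
BoundaryWithin G X S = ∀ i → label G i ∈ X → i ∈ S

Admissible : ∀ {t} (G : BGraph t) → Subset t → Subset (n (graph G)) → Set
Admissible G S X = Independent (graph G) X × BoundaryWithin G X S

IsS : ∀ {t} (G : BGraph t) → Subset t → ℕ → Set
IsS G S k =
  (Σ (Subset (n (graph G))) λ X → Admissible G S X × ∣ X ∣ ≡ k)
  × (∀ X → Admissible G S X → ∣ X ∣ ≤ k)

IsS0 : ∀ {t} (G : BGraph t) → Subset t → ℕ → Set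
IsS0 G S k = ∃ λ a → ∃ λ b → IsS G S a × IsS G ⊥ b × a ∸ b ≡ k

-- t-representative function f : 2^B → ℕ.
-- Condition (3) "f(S) ≤ 1 + min_{v∈S} f(S∖{v})" for nonempty S is
-- written as: for every v ∈ S, f(S) ≤ 1 + f(S∖{v}).
record Representative (t : ℕ) (f : Subset t → ℕ) : Set where
  field
    empty-zero : f ⊥ ≡ 0
    monotone   : ∀ S′ S → S′ ⊆ S → f S′ ≤ f S
    step       : ∀ S → Nonempty S → ∀ v → v ∈ S → f S ≤ suc (f (S - v))

module Submission where

-- Take the t boundary vertices, pairwise nonadjacent, and for every T ⊆ B an independent block of
-- |B ∖ T| + f(T) vertices, adjacent to the boundary vertices outside T and to all vertices of the
-- other blocks. An independent set X with X ∩ B ⊆ S meets at most one block; if it meets block T it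
-- lies in (S ∩ T) ∪ block(T), of size |S ∩ T| + |B ∖ T| + f(T) ≤ t + f(S ∩ T) ≤ t + f(S), since
-- condition (3) applied along T ∖ (S ∩ T) gives f(T) + |S ∩ T| ≤ |T| + f(S ∩ T). As S ∪ block(S)
-- attains t + f(S), we get 𝔰_G(S) = t + f(S) and hence 𝔰⁰_G(S) = f(S).

open import Data.Bool using (false)
open import Data.Empty using () renaming (⊥ to Empty)
open import Data.Fin using (Fin; zero; suc; _↑ˡ_; _↑ʳ_; splitAt; _≟_)
open import Data.Fin.Properties using (any?; splitAt-↑ˡ; splitAt-↑ʳ; splitAt⁻¹-↑ˡ; splitAt⁻¹-↑ʳ; ↑ˡ-injective)
open import Data.Fin.Subset using (Subset; inside; outside; _∈_; _∉_; _⊆_; _-_; ∣_∣; ⊥; ⊤; ∁; _∩_)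
open import Data.Fin.Subset.Properties
  using (_∈?_; ∈⊤; ∉⊥; ∣⊤∣≡n; ∣⊥∣≡0; ∣p∣≤n; ∣∁p∣≡n∸∣p∣; p⊆q⇒∣p∣≤∣q∣; x∈p⇒∣p-x∣<∣p∣;
         x∈p∧x≢y⇒x∈p-y; x∈p∩q⁺; p∩q⊆p; p∩q⊆q)
open import Data.List using (List; [_]; length; lookup; map) renaming (_++_ to _++ᴸ_)
open import Data.List.Membership.Propositional using () renaming (_∈_ to _∈ᴸ_)
import Data.List.Membership.Propositional.Properties as ∈ᴸ
open import Data.List.Relation.Unary.Any using (here; index)
open import Data.List.Relation.Unary.Any.Properties using (lookup-index)
open import Data.Nat using (ℕ; zero; suc; _+_; _∸_; _≤_; _≥_; z≤n; s≤s; +-0-rawMonoid)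
open import Data.Nat.Properties
  using (+-comm; +-assoc; +-identityʳ; +-mono-≤; +-monoˡ-≤; +-monoʳ-≤; ≤-refl; ≤-trans; ≤-pred;
         m∸n+n≡m; [m+n]∸[m+o]≡n∸o; module ≤-Reasoning)
open import Data.Product using (Σ; _×_; _,_)
open import Data.Sum using (_⊎_; inj₁; inj₂; [_,_]′)
import Data.Sum as Sum
open import Data.Vec using ([]; _∷_; _++_; here; there)
open import Function using (_∘_; const; id)
open import Function.Bundles using (mk⇔)
open import Relation.Binary.Definitions using (Decidable; Symmetric)
open import Relation.Binary.PropositionalEquality
  using (_≡_; _≢_; refl; sym; trans; cong; cong₂; subst; module ≡-Reasoning)
open import Relation.Nullary using (yes; no; ¬_; does; contradiction)
open import Relation.Nullary.Decidable using (dec-true; dec-false; does-⇔; decidable-stable; _×-dec_; ¬?)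

open import Defs using (Graph; adj; BGraph; Representative; Independent; Admissible; IsS; IsS0)
open import Algebra.Definitions.RawMonoid +-0-rawMonoid using (sum)

data Split (m n : ℕ) : Fin (m + n) → Set where
  left  : (i : Fin m) → Split m n (i ↑ˡ n)
  right : (j : Fin n) → Split m n (m ↑ʳ j)

split : ∀ m {n} (x : Fin (m + n)) → Split m n x
split m {n} x with splitAt m x in eq
... | inj₁ i = subst (Split m n) (splitAt⁻¹-↑ˡ eq) (left i)
... | inj₂ j = subst (Split m n) (splitAt⁻¹-↑ʳ eq) (right j)

∈-++⁺ˡ : ∀ {m n} {p : Subset m} {q : Subset n} {i} → i ∈ p → i ↑ˡ n ∈ p ++ q
∈-++⁺ˡ here        = here
∈-++⁺ˡ (there i∈p) = there (∈-++⁺ˡ i∈p)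

∈-++⁻ˡ : ∀ {m n} {p : Subset m} {q : Subset n} {i} → i ↑ˡ n ∈ p ++ q → i ∈ p
∈-++⁻ˡ {p = _ ∷ _} {i = zero}  here        = here
∈-++⁻ˡ {p = _ ∷ _} {i = suc _} (there i∈p) = there (∈-++⁻ˡ i∈p)

∈-++⁺ʳ : ∀ {m n} {p : Subset m} {q : Subset n} {j} → j ∈ q → m ↑ʳ j ∈ p ++ q
∈-++⁺ʳ {p = []}    j∈q = j∈q
∈-++⁺ʳ {p = _ ∷ _} j∈q = there (∈-++⁺ʳ j∈q)

∈-++⁻ʳ : ∀ {m n} {p : Subset m} {q : Subset n} {j} → m ↑ʳ j ∈ p ++ q → j ∈ q
∈-++⁻ʳ {p = []}    j∈q         = j∈q
∈-++⁻ʳ {p = _ ∷ _} (there j∈q) = ∈-++⁻ʳ j∈q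

⊆-++ : ∀ {m n} {X : Subset (m + n)} {p : Subset m} {q : Subset n} →
       (∀ i → i ↑ˡ n ∈ X → i ∈ p) → (∀ j → m ↑ʳ j ∈ X → j ∈ q) → X ⊆ p ++ q
⊆-++ {m} ˡ⊆p ʳ⊆q {x} x∈X with split m x
... | left i  = ∈-++⁺ˡ (ˡ⊆p i x∈X)
... | right j = ∈-++⁺ʳ (ʳ⊆q j x∈X)

∣p++q∣≡∣p∣+∣q∣ : ∀ {m n} (p : Subset m) (q : Subset n) → ∣ p ++ q ∣ ≡ ∣ p ∣ + ∣ q ∣
∣p++q∣≡∣p∣+∣q∣ []            q = refl
∣p++q∣≡∣p∣+∣q∣ (inside  ∷ p) q = cong suc (∣p++q∣≡∣p∣+∣q∣ p q)
∣p++q∣≡∣p∣+∣q∣ (outside ∷ p) q = ∣p++q∣≡∣p∣+∣q∣ p q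

∣∁p∣+∣p∣≡n : ∀ {n} (p : Subset n) → ∣ ∁ p ∣ + ∣ p ∣ ≡ n
∣∁p∣+∣p∣≡n p = trans (cong (_+ ∣ p ∣) (∣∁p∣≡n∸∣p∣ p)) (m∸n+n≡m (∣p∣≤n p))

subsets : ∀ n → List (Subset n)
subsets zero    = [ [] ]
subsets (suc n) = map (inside ∷_) (subsets n) ++ᴸ map (outside ∷_) (subsets n)

∈-subsets : ∀ {n} (p : Subset n) → p ∈ᴸ subsets n
∈-subsets []            = here refl
∈-subsets (inside  ∷ p) = ∈ᴸ.∈-++⁺ˡ (∈ᴸ.∈-map⁺ (inside ∷_) (∈-subsets p))
∈-subsets (outside ∷ p) = ∈ᴸ.∈-++⁺ʳ _ (∈ᴸ.∈-map⁺ (outside ∷_) (∈-subsets p))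

module Blocks where

  blockOf : ∀ {m} (c : Fin m → ℕ) → Fin (sum c) → Fin m
  blockOf {suc m} c x = [ const zero , suc ∘ blockOf (c ∘ suc) ]′ (splitAt (c zero) x)

  block : ∀ {m} (c : Fin m → ℕ) → Fin m → Subset (sum c)
  block {suc m} c zero    = ⊤ {c zero} ++ ⊥
  block {suc m} c (suc j) = ⊥ {c zero} ++ block (c ∘ suc) j

  ∣block∣ : ∀ {m} (c : Fin m → ℕ) j → ∣ block c j ∣ ≡ c j
  ∣block∣ {suc m} c zero = begin
    ∣ ⊤ {c zero} ++ ⊥ ∣                     ≡⟨ ∣p++q∣≡∣p∣+∣q∣ (⊤ {c zero}) ⊥ ⟩
    ∣ ⊤ {c zero} ∣ + ∣ ⊥ {sum (c ∘ suc)} ∣   ≡⟨ cong₂ _+_ (∣⊤∣≡n (c zero)) (∣⊥∣≡0 (sum (c ∘ suc))) ⟩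
    c zero + 0                              ≡⟨ +-identityʳ (c zero) ⟩
    c zero                                  ∎
    where open ≡-Reasoning
  ∣block∣ {suc m} c (suc j) = begin
    ∣ ⊥ {c zero} ++ block (c ∘ suc) j ∣      ≡⟨ ∣p++q∣≡∣p∣+∣q∣ (⊥ {c zero}) (block (c ∘ suc) j) ⟩
    ∣ ⊥ {c zero} ∣ + ∣ block (c ∘ suc) j ∣   ≡⟨ cong₂ _+_ (∣⊥∣≡0 (c zero)) (∣block∣ (c ∘ suc) j) ⟩
    c (suc j)                               ∎
    where open ≡-Reasoning

  blockOf-↑ˡ : ∀ {m} (c : Fin (suc m) → ℕ) i → blockOf c (i ↑ˡ sum (c ∘ suc)) ≡ zero
  blockOf-↑ˡ c i rewrite splitAt-↑ˡ (c zero) i (sum (c ∘ suc)) = refl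

  blockOf-↑ʳ : ∀ {m} (c : Fin (suc m) → ℕ) j → blockOf c (c zero ↑ʳ j) ≡ suc (blockOf (c ∘ suc) j)
  blockOf-↑ʳ c j rewrite splitAt-↑ʳ (c zero) (sum (c ∘ suc)) j = refl

  ∈-block : ∀ {m} (c : Fin m → ℕ) x → x ∈ block c (blockOf c x)
  ∈-block {suc m} c x with split (c zero) x
  ... | left i  rewrite blockOf-↑ˡ c i = ∈-++⁺ˡ {c zero} ∈⊤
  ... | right j rewrite blockOf-↑ʳ c j = ∈-++⁺ʳ {c zero} (∈-block (c ∘ suc) j)

  ∈-block⁻ : ∀ {m} (c : Fin m → ℕ) {j} x → x ∈ block c j → blockOf c x ≡ j
  ∈-block⁻ {suc m} c {j} x x∈b with split (c zero) x | j
  ... | left i  | zero  = blockOf-↑ˡ c i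
  ... | left i  | suc _ = contradiction (∈-++⁻ˡ {c zero} x∈b) ∉⊥
  ... | right _ | zero  = contradiction (∈-++⁻ʳ {c zero} x∈b) ∉⊥
  ... | right k | suc j = trans (blockOf-↑ʳ c k) (cong suc (∈-block⁻ (c ∘ suc) k (∈-++⁻ʳ {c zero} x∈b)))

module RepresentativeProperties {t : ℕ} {f : Subset t → ℕ} (rep : Representative t f) where
  open Representative rep

  lipschitz-bounded : ∀ k {R T} → R ⊆ T → ∣ T ∣ ≤ k → f T + ∣ R ∣ ≤ k + f R
  lipschitz-bounded k {R} {T} R⊆T ∣T∣≤k with any? (λ v → v ∈? T ×-dec ¬? (v ∈? R))
  ... | no ∄v = begin
    f T + ∣ R ∣ ≤⟨ +-mono-≤ (monotone T R T⊆R) (≤-trans (p⊆q⇒∣p∣≤∣q∣ R⊆T) ∣T∣≤k) ⟩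
    f R + k     ≡⟨ +-comm (f R) k ⟩
    k + f R     ∎
    where
    open ≤-Reasoning
    T⊆R : T ⊆ R
    T⊆R {v} v∈T with v ∈? R
    ... | yes v∈R = v∈R
    ... | no  v∉R = contradiction (v , v∈T , v∉R) ∄v
  ... | yes (v , v∈T , v∉R) with k
  ...   | zero  = contradiction (≤-trans (x∈p⇒∣p-x∣<∣p∣ v∈T) ∣T∣≤k) λ ()
  ...   | suc k = begin
    f T + ∣ R ∣               ≤⟨ +-monoˡ-≤ ∣ R ∣ (step T (v , v∈T) v v∈T) ⟩
    suc (f (T - v) + ∣ R ∣)   ≤⟨ s≤s (lipschitz-bounded k R⊆T-v ∣T-v∣≤k) ⟩
    suc (k + f R)             ∎
    where
    open ≤-Reasoning
    R⊆T-v : R ⊆ T - v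
    R⊆T-v x∈R = x∈p∧x≢y⇒x∈p-y (R⊆T x∈R) λ { refl → v∉R x∈R }
    ∣T-v∣≤k : ∣ T - v ∣ ≤ k
    ∣T-v∣≤k = ≤-pred (≤-trans (x∈p⇒∣p-x∣<∣p∣ v∈T) ∣T∣≤k)

  lipschitz : ∀ {R T} → R ⊆ T → f T + ∣ R ∣ ≤ ∣ T ∣ + f R
  lipschitz R⊆T = lipschitz-bounded _ R⊆T ≤-refl

module InducedGraph {C : Set} {_~_ : C → C → Set} (_~?_ : Decidable _~_)
                    (~-sym : Symmetric _~_) (~-irrefl : ∀ a → ¬ a ~ a) {n : ℕ} (class : Fin n → C) where

  induced : Graph
  induced = record
    { n      = n
    ; adj    = λ x y → does (class x ~? class y)
    ; sym    = λ x y → does-⇔ (mk⇔ ~-sym ~-sym) (class x ~? class y) (class y ~? class x)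
    ; irrefl = λ x → dec-false (class x ~? class x) (~-irrefl (class x))
    }

  nonadjacent⇒≁ : ∀ {x y} → adj induced x y ≡ false → ¬ class x ~ class y
  nonadjacent⇒≁ {x} {y} x≁y x~y with () ← trans (sym (dec-true (class x ~? class y) x~y)) x≁y

  ≁⇒nonadjacent : ∀ {x y} → ¬ class x ~ class y → adj induced x y ≡ false
  ≁⇒nonadjacent {x} {y} = dec-false (class x ~? class y)

module Construction {t : ℕ} (f : Subset t → ℕ) (Ts : List (Subset t)) where
  open Blocks

  T : Fin (length Ts) → Subset t
  T = lookup Ts

  size : Fin (length Ts) → ℕ
  size j = ∣ ∁ (T j) ∣ + f (T j)

  M : ℕ
  M = sum size

  Class : Set
  Class = Fin t ⊎ Fin (length Ts)

  class : Fin (t + M) → Class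
  class x = Sum.map₂ (blockOf size) (splitAt t x)

  class-↑ˡ : ∀ i → class (i ↑ˡ M) ≡ inj₁ i
  class-↑ˡ i = cong (Sum.map₂ (blockOf size)) (splitAt-↑ˡ t i M)

  class-↑ʳ : ∀ w → class (t ↑ʳ w) ≡ inj₂ (blockOf size w)
  class-↑ʳ w = cong (Sum.map₂ (blockOf size)) (splitAt-↑ʳ t M w)

  _~_ : Class → Class → Set
  inj₁ _ ~ inj₁ _ = Empty
  inj₁ i ~ inj₂ j = i ∉ T j
  inj₂ j ~ inj₁ i = i ∉ T j
  inj₂ j ~ inj₂ k = j ≢ k

  _~?_ : Decidable _~_
  inj₁ _ ~? inj₁ _ = no λ ()
  inj₁ i ~? inj₂ j = ¬? (i ∈? T j)
  inj₂ j ~? inj₁ i = ¬? (i ∈? T j)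
  inj₂ j ~? inj₂ k = ¬? (j ≟ k)

  ~-sym : Symmetric _~_
  ~-sym {inj₁ _} {inj₂ _} i∉T = i∉T
  ~-sym {inj₂ _} {inj₁ _} i∉T = i∉T
  ~-sym {inj₂ _} {inj₂ _} j≢k = j≢k ∘ sym

  ~-irrefl : ∀ a → ¬ a ~ a
  ~-irrefl (inj₁ _) ()
  ~-irrefl (inj₂ j) j≢j = j≢j refl

  open InducedGraph _~?_ ~-sym ~-irrefl class

  G : BGraph t
  G = record
    { graph     = induced
    ; label     = _↑ˡ M
    ; label-inj = ↑ˡ-injective M _ _
    }

  nonadjacent-classes : ∀ {x y a b} → class x ≡ a → class y ≡ b → adj induced x y ≡ false → ¬ a ~ b
  nonadjacent-classes refl refl = nonadjacent⇒≁

  Within : Subset t → Fin (length Ts) → Class → Set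
  Within R j (inj₁ i) = i ∈ R
  Within R j (inj₂ k) = k ≡ j

  ∈-within⁻ : ∀ {R j} x → x ∈ R ++ block size j → Within R j (class x)
  ∈-within⁻ x x∈ with split t x
  ... | left i  rewrite class-↑ˡ i = ∈-++⁻ˡ x∈
  ... | right w rewrite class-↑ʳ w = ∈-block⁻ size w (∈-++⁻ʳ {t} x∈)

  ∈-within⁺ : ∀ {R j} x → Within R j (class x) → x ∈ R ++ block size j
  ∈-within⁺ x within with split t x
  ... | left i  rewrite class-↑ˡ i = ∈-++⁺ˡ within
  ... | right w rewrite class-↑ʳ w = ∈-++⁺ʳ {t} (subst (λ k → w ∈ block size k) within (∈-block size w))

  within-≁ : ∀ {R j} → R ⊆ T j → ∀ a b → Within R j a → Within R j b → ¬ a ~ b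
  within-≁ R⊆T (inj₁ _) (inj₁ _) _ _ ()
  within-≁ R⊆T (inj₁ i) (inj₂ _) i∈R refl i∉T = i∉T (R⊆T i∈R)
  within-≁ R⊆T (inj₂ _) (inj₁ i) refl i∈R i∉T = i∉T (R⊆T i∈R)
  within-≁ R⊆T (inj₂ _) (inj₂ _) refl refl j≢j = j≢j refl

  ∣within∣ : ∀ (R : Subset t) j → ∣ R ++ block size j ∣ ≡ ∣ R ∣ + size j
  ∣within∣ R j = trans (∣p++q∣≡∣p∣+∣q∣ R (block size j)) (cong (∣ R ∣ +_) (∣block∣ size j))

  witness : ∀ {S} j → T j ≡ S → Σ (Subset (t + M)) λ X → Admissible G S X × ∣ X ∣ ≡ t + f S
  witness j refl = T j ++ block size j , (independent , λ _ → ∈-++⁻ˡ) , ∣within∣≡t+f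
    where
    independent : Independent induced (T j ++ block size j)
    independent x y x∈ y∈ =
      ≁⇒nonadjacent (within-≁ id (class x) (class y) (∈-within⁻ x x∈) (∈-within⁻ y y∈))
    ∣within∣≡t+f : ∣ T j ++ block size j ∣ ≡ t + f (T j)
    ∣within∣≡t+f = begin
      ∣ T j ++ block size j ∣            ≡⟨ ∣within∣ (T j) j ⟩
      ∣ T j ∣ + (∣ ∁ (T j) ∣ + f (T j))   ≡⟨ +-assoc ∣ T j ∣ _ _ ⟨
      ∣ T j ∣ + ∣ ∁ (T j) ∣ + f (T j)     ≡⟨ cong (_+ f (T j)) (+-comm ∣ T j ∣ _) ⟩
      ∣ ∁ (T j) ∣ + ∣ T j ∣ + f (T j)     ≡⟨ cong (_+ f (T j)) (∣∁p∣+∣p∣≡n (T j)) ⟩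
      t + f (T j)                         ∎
      where open ≡-Reasoning

  independent-within : ∀ {S X} → Admissible G S X → ∀ w₀ → t ↑ʳ w₀ ∈ X →
                       ∀ x → x ∈ X → Within (S ∩ T (blockOf size w₀)) (blockOf size w₀) (class x)
  independent-within {S} (independent , boundary) w₀ w₀∈X x x∈X with split t x
  ... | left i  rewrite class-↑ˡ i = x∈p∩q⁺ (boundary i x∈X , decidable-stable (i ∈? _) w₀≁x)
    where w₀≁x = nonadjacent-classes (class-↑ʳ w₀) (class-↑ˡ i) (independent _ _ w₀∈X x∈X)
  ... | right w rewrite class-↑ʳ w = sym (decidable-stable (_ ≟ _) w₀≁x)
    where w₀≁x = nonadjacent-classes (class-↑ʳ w₀) (class-↑ʳ w) (independent _ _ w₀∈X x∈X)

  module _ (rep : Representative t f) where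
    open Representative rep
    open RepresentativeProperties rep

    within-size≤ : ∀ {R} j → R ⊆ T j → ∣ R ∣ + size j ≤ t + f R
    within-size≤ {R} j R⊆T = begin
      ∣ R ∣ + (∣ ∁ (T j) ∣ + f (T j))   ≡⟨ +-comm ∣ R ∣ _ ⟩
      ∣ ∁ (T j) ∣ + f (T j) + ∣ R ∣     ≡⟨ +-assoc ∣ ∁ (T j) ∣ _ _ ⟩
      ∣ ∁ (T j) ∣ + (f (T j) + ∣ R ∣)   ≤⟨ +-monoʳ-≤ ∣ ∁ (T j) ∣ (lipschitz R⊆T) ⟩
      ∣ ∁ (T j) ∣ + (∣ T j ∣ + f R)     ≡⟨ +-assoc ∣ ∁ (T j) ∣ _ _ ⟨
      ∣ ∁ (T j) ∣ + ∣ T j ∣ + f R       ≡⟨ cong (_+ f R) (∣∁p∣+∣p∣≡n (T j)) ⟩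
      t + f R                           ∎
      where open ≤-Reasoning

    admissible-bound : ∀ S X → Admissible G S X → ∣ X ∣ ≤ t + f S
    admissible-bound S X (independent , boundary) with any? (λ w → t ↑ʳ w ∈? X)
    ... | no ∄w = begin
      ∣ X ∣               ≤⟨ p⊆q⇒∣p∣≤∣q∣ (⊆-++ boundary λ w w∈X → contradiction (w , w∈X) ∄w) ⟩
      ∣ S ++ ⊥ {M} ∣      ≡⟨ ∣p++q∣≡∣p∣+∣q∣ S ⊥ ⟩
      ∣ S ∣ + ∣ ⊥ {M} ∣   ≡⟨ cong (∣ S ∣ +_) (∣⊥∣≡0 M) ⟩
      ∣ S ∣ + 0           ≤⟨ +-mono-≤ (∣p∣≤n S) z≤n ⟩
      t + f S             ∎
      where open ≤-Reasoning
    ... | yes (w₀ , w₀∈X) = begin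
      ∣ X ∣                              ≤⟨ p⊆q⇒∣p∣≤∣q∣ X⊆ ⟩
      ∣ (S ∩ T j₀) ++ block size j₀ ∣    ≡⟨ ∣within∣ (S ∩ T j₀) j₀ ⟩
      ∣ S ∩ T j₀ ∣ + size j₀             ≤⟨ within-size≤ j₀ (p∩q⊆q S (T j₀)) ⟩
      t + f (S ∩ T j₀)                   ≤⟨ +-monoʳ-≤ t (monotone _ _ (p∩q⊆p S (T j₀))) ⟩
      t + f S                            ∎
      where
      open ≤-Reasoning
      j₀ = blockOf size w₀
      X⊆ : X ⊆ (S ∩ T j₀) ++ block size j₀
      X⊆ {x} x∈X = ∈-within⁺ x (independent-within (independent , boundary) w₀ w₀∈X x x∈X)

    𝔰≡t+f : ∀ S → S ∈ᴸ Ts → IsS G S (t + f S)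
    𝔰≡t+f S S∈Ts = witness (index S∈Ts) (sym (lookup-index S∈Ts)) , admissible-bound S

lemma13 : (t : ℕ) → t ≥ 1 → (f : Subset t → ℕ) → Representative t f →
    Σ (BGraph t) λ G → ∀ (S : Subset t) → IsS0 G S (f S)
lemma13 t _ f rep =
  G , λ S → t + f S , t + f ⊥ , 𝔰≡t+f rep S (∈-subsets S) , 𝔰≡t+f rep ⊥ (∈-subsets ⊥) , difference S
  where
  open Construction f (subsets t)
  open Representative rep
  difference : ∀ S → t + f S ∸ (t + f ⊥) ≡ f S
  difference S = trans ([m+n]∸[m+o]≡n∸o t (f S) (f ⊥)) (cong (f S ∸_) empty-zero)
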